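{- Let $f,g,h$ be quasi-polynomials with $f(t)=g(t)+h(t)$. Then $f^{\sigma}(t)=g^{\sigma}(t)+h^{\sigma}(t)$.
   Context: A quasi-polynomial is a function $f:\mathbb{Z}\to\mathbb{C}$ for which there exist a positive integer $N$ (a period) and polynomials $f_1,\dots,f_N\in\mathbb{C}[t]$ (constituents) with $f(t)=f_j(t)$ whenever $t\equiv j\bmod N$ (index $N$ for $t\equiv0$); the minimal period is the least period. For a quasi-polynomial $f$ with minimal period $N$ and constituents $f_1,\dots,f_N$ (indices read mod $N$), $f^\sigma$ is the quasi-polynomial with $f^\sigma(t)=f_{j-1}(t)$ for $t\equiv j\bmod N$ (i.e. $\sigma$ is the cyclic permutation $(1,2,\dots,N)$ for the minimal period of the quasi-polynomial it acts on, and $f^\sigma(t)=f_{\sigma^{ -1}(j)}(t)$). Here $\sigma$ is taken with respect to the minimal period of each of $f,g,h$ separately. -}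

module Defs where

open import Level using (Level)
open import Algebra.Bundles using (CommutativeRing)
open import Data.Nat as ℕ using (ℕ; zero; suc; NonZero; _≤_)
open import Data.Integer as ℤ using (ℤ; +_; -[1+_]; _%ℕ_)
open import Data.List using (List; []; _∷_)
open import Data.Product using (Σ; _×_)
open import Data.Sum using (_⊎_)
open import Relation.Nullary using (¬_)

-- Everything is relative to a coefficient ring R (standing in for ℂ).
module QP {c ℓ : Level} (R : CommutativeRing c ℓ) where
  open CommutativeRing R

  -- A polynomial is its list of coefficients, constant term first.
  Poly : Set c
  Poly = List Carrier

  eval : Poly → Carrier → Carrier
  eval []       x = 0#
  eval (a ∷ as) x = a + x * eval as x

  natR : ℕ → Carrier
  natR zero    = 0#
  natR (suc n) = 1# + natR n

  intR : ℤ → Carrier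
  intR (+ n)     = natR n
  intR -[1+ n ]  = - natR (suc n)

  -- Hypotheses making R behave like ℂ for this purpose.
  IsIntegralDomain : Set (c Level.⊔ ℓ)
  IsIntegralDomain = ∀ x y → x * y ≈ 0# → (x ≈ 0#) ⊎ (y ≈ 0#)

  CharZero : Set ℓ
  CharZero = ∀ n → ¬ (natR (suc n) ≈ 0#)

  -- f is a quasi-polynomial with period N and constituents cs:
  -- f(t) = cs (t mod N) evaluated at t, where residue 0 plays the role of
  -- the paper's index N.  (Values of cs at indices ≥ N are irrelevant.)
  IsQP : (f : ℤ → Carrier) (N : ℕ) .{{_ : NonZero N}} (cs : ℕ → Poly) → Set ℓ
  IsQP f N cs = ∀ t → f t ≈ eval (cs (t %ℕ N)) (intR t)

  HasPeriod : (f : ℤ → Carrier) (N : ℕ) .{{_ : NonZero N}} → Set (c Level.⊔ ℓ)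
  HasPeriod f N = Σ (ℕ → Poly) (λ cs → IsQP f N cs)

  IsMinimalPeriod : (f : ℤ → Carrier) (N : ℕ) .{{_ : NonZero N}} → Set (c Level.⊔ ℓ)
  IsMinimalPeriod f N =
    HasPeriod f N × (∀ M → .{{_ : NonZero M}} → HasPeriod f M → N ≤ M)

  -- f^σ computed from the (minimal-period) data N, cs:
  -- f^σ(t) = f_{j-1}(t) for t ≡ j mod N.
  sigma : (N : ℕ) .{{_ : NonZero N}} (cs : ℕ → Poly) → ℤ → Carrier
  sigma N cs t = eval (cs ((t ℤ.- ℤ.1ℤ) %ℕ N)) (intR t)

-- Let s = t - 1 and L = Nf·Ng·Nh. On the residue class of s modulo L all three
-- quasi-polynomials are given by the constituents indexed by the residue of s,
-- so the polynomial identity f_s = g_s + h_s holds at infinitely many points of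
-- that class. In an integral domain of characteristic zero this forces it to
-- hold identically, in particular at t, which is the claim.
module Submission where

open import Defs
open import Level using (Level)
open import Algebra.Bundles using (CommutativeRing)
open import Data.Nat using (ℕ; NonZero)
open import Data.Integer using (ℤ)
open import Data.List using (List)

import Data.Nat as ℕ
open import Data.Nat using (zero; suc; _%_)
open import Data.Nat.Properties using (suc-injective; +-cancelˡ-≡; *-cancelʳ-≡; m*n≢0)
open import Data.Nat.DivMod using (%-remove-+ʳ)
open import Data.Nat.Divisibility using (_∣_; m∣m*n; n∣m*n; n∣m*n*o; ∣m⇒∣m*n; ∣n⇒∣m*n)
import Data.Integer as ℤ
open import Data.Integer using (+_; -[1+_]; _%ℕ_)
open import Data.List using ([]; _∷_; length; map)
open import Data.Maybe using (nothing)
open import Data.Sum using (inj₁; inj₂)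
open import Data.Empty using (⊥-elim)
open import Relation.Binary.PropositionalEquality as ≡ using (_≡_)
import Algebra.Properties.Ring as RingProperties
import Algebra.Solver.Ring as RingSolver
import Algebra.Solver.Ring.AlmostCommutativeRing as AlmostCommutativeRing

-[1+]%ℕ-cong : ∀ {a b} d .{{_ : NonZero d}} →
               suc a % d ≡ suc b % d → -[1+ a ] %ℕ d ≡ -[1+ b ] %ℕ d
-[1+]%ℕ-cong {a} {b} d eq with suc a % d | suc b % d | eq
... | zero  | ._ | ≡.refl = ≡.refl
... | suc _ | ._ | ≡.refl = ≡.refl

-- Unlike i + m, moving away from zero keeps the sign, so the residue of the
-- result is governed by a residue of natural numbers even for negative i.
awayFromZero : ℤ → ℕ → ℤ
awayFromZero (+ a)    m = + (a ℕ.+ m)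
awayFromZero -[1+ a ] m = -[1+ a ℕ.+ m ]

awayFromZero-%ℕ : ∀ i {m} d .{{_ : NonZero d}} → d ∣ m → awayFromZero i m %ℕ d ≡ i %ℕ d
awayFromZero-%ℕ (+ a)    d d∣m = %-remove-+ʳ a d∣m
awayFromZero-%ℕ -[1+ a ] d d∣m = -[1+]%ℕ-cong d (%-remove-+ʳ (suc a) d∣m)

module QuasiPolynomials {r ℓ : Level} (R : CommutativeRing r ℓ) where
  open CommutativeRing R
  open QP R
  open RingProperties ring
    using (-0#≈0#; +-cancelˡ; -‿injective; -‿+-comm; -‿distribʳ-*; //-rightDividesˡ;
           x∙y⁻¹≈ε⇒x≈y; x≈y⇒x∙y⁻¹≈ε)
  open import Relation.Binary.Reasoning.Setoid setoid

  private
    ACR = AlmostCommutativeRing.fromCommutativeRing R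
    open RingSolver (AlmostCommutativeRing.AlmostCommutativeRing.rawRing ACR) ACR
      (AlmostCommutativeRing.-raw-almostCommutative⟶ ACR) (λ _ _ → nothing)

  natR-suc-injective : ∀ {m n} → natR (suc m) ≈ natR (suc n) → natR m ≈ natR n
  natR-suc-injective e = +-cancelˡ 1# _ _ e

  natR-injective : CharZero → ∀ {m n} → natR m ≈ natR n → m ≡ n
  natR-injective char0 {zero}  {zero}  e = ≡.refl
  natR-injective char0 {zero}  {suc n} e = ⊥-elim (char0 n (sym e))
  natR-injective char0 {suc m} {zero}  e = ⊥-elim (char0 m e)
  natR-injective char0 {suc m} {suc n} e =
    ≡.cong suc (natR-injective char0 (natR-suc-injective {m} {n} e))

  intR-awayFromZero-injective : CharZero → ∀ i {m n} →
                                intR (awayFromZero i m) ≈ intR (awayFromZero i n) → m ≡ n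
  intR-awayFromZero-injective char0 (+ a) {m} {n} e =
    +-cancelˡ-≡ a _ _ (natR-injective char0 {a ℕ.+ m} {a ℕ.+ n} e)
  intR-awayFromZero-injective char0 -[1+ a ] {m} {n} e =
    +-cancelˡ-≡ a _ _ (natR-injective char0 (natR-suc-injective {a ℕ.+ m} {a ℕ.+ n} (-‿injective e)))

  _+ₚ_ : Poly → Poly → Poly
  []       +ₚ q        = q
  (a ∷ as) +ₚ []       = a ∷ as
  (a ∷ as) +ₚ (b ∷ bs) = (a + b) ∷ (as +ₚ bs)

  -ₚ_ : Poly → Poly
  -ₚ_ = map (-_)

  eval-cong : ∀ p {x y} → x ≈ y → eval p x ≈ eval p y
  eval-cong []       e = refl
  eval-cong (a ∷ as) e = +-congˡ (*-cong e (eval-cong as e))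

  eval-+ₚ : ∀ p q x → eval (p +ₚ q) x ≈ eval p x + eval q x
  eval-+ₚ []       q        x = sym (+-identityˡ _)
  eval-+ₚ (a ∷ as) []       x = sym (+-identityʳ _)
  eval-+ₚ (a ∷ as) (b ∷ bs) x = begin
    (a + b) + x * eval (as +ₚ bs) x
      ≈⟨ +-congˡ (*-congˡ (eval-+ₚ as bs x)) ⟩
    (a + b) + x * (eval as x + eval bs x)
      ≈⟨ solve 5 (λ a b x u v → (a :+ b) :+ x :* (u :+ v) := (a :+ x :* u) :+ (b :+ x :* v))
               refl a b x (eval as x) (eval bs x) ⟩
    (a + x * eval as x) + (b + x * eval bs x) ∎

  eval--ₚ : ∀ p x → eval (-ₚ p) x ≈ - eval p x
  eval--ₚ []       x = sym -0#≈0#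
  eval--ₚ (a ∷ as) x = begin
    - a + x * eval (-ₚ as) x ≈⟨ +-congˡ (*-congˡ (eval--ₚ as x)) ⟩
    - a + x * - eval as x    ≈⟨ +-congˡ (sym (-‿distribʳ-* x (eval as x))) ⟩
    - a + - (x * eval as x)  ≈⟨ -‿+-comm a (x * eval as x) ⟩
    - (a + x * eval as x)    ∎

  -- Synthetic division: the coefficients of the quotient of a ∷ bs by X - c
  -- are the values at c of the successive tails of bs.
  synthetic : Carrier → Poly → Poly
  synthetic c []       = []
  synthetic c (b ∷ bs) = eval (b ∷ bs) c ∷ synthetic c bs

  length-synthetic : ∀ c bs → length (synthetic c bs) ≡ length bs
  length-synthetic c []       = ≡.refl
  length-synthetic c (b ∷ bs) = ≡.cong suc (length-synthetic c bs)

  x*eval-synthetic : ∀ c d bs →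
                     (d + c) * eval bs (d + c) ≈ d * eval (synthetic c bs) (d + c) + c * eval bs c
  x*eval-synthetic c d []       = solve 3 (λ d c z → (d :+ c) :* z := d :* z :+ c :* z) refl d c 0#
  x*eval-synthetic c d (b ∷ bs) = begin
    (d + c) * (b + (d + c) * eval bs (d + c))
      ≈⟨ *-congˡ (+-congˡ (x*eval-synthetic c d bs)) ⟩
    (d + c) * (b + (d * S + c * e))
      ≈⟨ solve 5 (λ d c b S e → (d :+ c) :* (b :+ (d :* S :+ c :* e))
                                := d :* ((b :+ c :* e) :+ (d :+ c) :* S) :+ c :* (b :+ c :* e))
               refl d c b S e ⟩
    d * ((b + c * e) + (d + c) * S) + c * (b + c * e) ∎
    where
    S = eval (synthetic c bs) (d + c)
    e = eval bs c

  factor-theorem : ∀ c d a as →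
                   eval (a ∷ as) (d + c) ≈ d * eval (synthetic c as) (d + c) + eval (a ∷ as) c
  factor-theorem c d a as = begin
    a + (d + c) * eval as (d + c)
      ≈⟨ +-congˡ (x*eval-synthetic c d as) ⟩
    a + (d * eval (synthetic c as) (d + c) + c * eval as c)
      ≈⟨ solve 3 (λ a u w → a :+ (u :+ w) := u :+ (a :+ w)) refl a _ (c * eval as c) ⟩
    d * eval (synthetic c as) (d + c) + (a + c * eval as c) ∎

  root⇒factor : ∀ c a as y → eval (a ∷ as) c ≈ 0# →
                eval (a ∷ as) y ≈ (y - c) * eval (synthetic c as) y
  root⇒factor c a as y root = begin
    eval (a ∷ as) y
      ≈⟨ eval-cong (a ∷ as) (sym (//-rightDividesˡ c y)) ⟩
    eval (a ∷ as) ((y - c) + c)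
      ≈⟨ factor-theorem c (y - c) a as ⟩
    (y - c) * eval Q ((y - c) + c) + eval (a ∷ as) c
      ≈⟨ +-cong (*-congˡ (eval-cong Q (//-rightDividesˡ c y))) root ⟩
    (y - c) * eval Q y + 0#
      ≈⟨ +-identityʳ _ ⟩
    (y - c) * eval Q y ∎
    where
    Q = synthetic c as

  module _ (integral : IsIntegralDomain) where

    -- Induction on the length: dividing by X - x₀ leaves a shorter polynomial
    -- that still vanishes at x₁, x₂, …, since x_{k+1} - x₀ is not a zero divisor.
    vanishing-on-injective : ∀ n p → length p ≡ n →
                             (x : ℕ → Carrier) → (∀ {i j} → x i ≈ x j → i ≡ j) →
                             (∀ k → eval p (x k) ≈ 0#) → ∀ y → eval p y ≈ 0#
    vanishing-on-injective _       []       _  x x-inj zeros y = refl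
    vanishing-on-injective (suc n) (a ∷ as) len x x-inj zeros y = begin
      eval (a ∷ as) y        ≈⟨ root⇒factor c a as y (zeros 0) ⟩
      (y - c) * eval Q y     ≈⟨ *-congˡ (Q-vanishes y) ⟩
      (y - c) * 0#           ≈⟨ zeroʳ _ ⟩
      0#                     ∎
      where
      c = x 0
      Q = synthetic c as
      Q-vanishes-on-tail : ∀ k → eval Q (x (suc k)) ≈ 0#
      Q-vanishes-on-tail k
        with integral (x (suc k) - c) (eval Q (x (suc k)))
                      (trans (sym (root⇒factor c a as (x (suc k)) (zeros 0))) (zeros (suc k)))
      ... | inj₁ xₖ-c≈0 with x-inj (x∙y⁻¹≈ε⇒x≈y _ _ xₖ-c≈0)
      ...   | ()
      Q-vanishes-on-tail k | inj₂ Qxₖ≈0 = Qxₖ≈0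
      Q-vanishes : ∀ y → eval Q y ≈ 0#
      Q-vanishes =
        vanishing-on-injective n Q (≡.trans (length-synthetic c as) (suc-injective len))
          (λ k → x (suc k)) (λ e → suc-injective (x-inj e)) Q-vanishes-on-tail

    eval-agree-on-injective : (x : ℕ → Carrier) → (∀ {i j} → x i ≈ x j → i ≡ j) →
                              ∀ p q → (∀ k → eval p (x k) ≈ eval q (x k)) →
                              ∀ y → eval p y ≈ eval q y
    eval-agree-on-injective x x-inj p q agree y =
      x∙y⁻¹≈ε⇒x≈y _ _ (trans (sym (eval-difference y))
        (vanishing-on-injective _ (p +ₚ (-ₚ q)) ≡.refl x x-inj
          (λ k → trans (eval-difference (x k)) (x≈y⇒x∙y⁻¹≈ε (agree k))) y))
      where
      eval-difference : ∀ z → eval (p +ₚ (-ₚ q)) z ≈ eval p z - eval q z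
      eval-difference z = trans (eval-+ₚ p (-ₚ q) z) (+-congˡ (eval--ₚ q z))

  constituent-on-progression : ∀ f N .{{_ : NonZero N}} cs → IsQP f N cs →
                               ∀ i {m} → N ∣ m →
                               f (awayFromZero i m) ≈ eval (cs (i %ℕ N)) (intR (awayFromZero i m))
  constituent-on-progression f N cs qp i {m} N∣m =
    trans (qp (awayFromZero i m))
          (reflexive (≡.cong (λ r → eval (cs r) _) (awayFromZero-%ℕ i N N∣m)))

  sigma-+ : IsIntegralDomain → CharZero → (f g h : ℤ → Carrier) →
            (Nf Ng Nh : ℕ) .{{_ : NonZero Nf}} .{{_ : NonZero Ng}} .{{_ : NonZero Nh}} →
            (cf cg ch : ℕ → Poly) → IsQP f Nf cf → IsQP g Ng cg → IsQP h Nh ch →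
            (∀ t → f t ≈ g t + h t) → ∀ t → sigma Nf cf t ≈ sigma Ng cg t + sigma Nh ch t
  sigma-+ integral char0 f g h Nf Ng Nh cf cg ch qf qg qh f≈g+h t = begin
    eval Pf (intR t)
      ≈⟨ eval-agree-on-injective integral x x-injective Pf (Pg +ₚ Ph) agree (intR t) ⟩
    eval (Pg +ₚ Ph) (intR t)
      ≈⟨ eval-+ₚ Pg Ph (intR t) ⟩
    eval Pg (intR t) + eval Ph (intR t) ∎
    where
    s = t ℤ.- ℤ.1ℤ
    Pf = cf (s %ℕ Nf)
    Pg = cg (s %ℕ Ng)
    Ph = ch (s %ℕ Nh)
    L = Nf ℕ.* Ng ℕ.* Nh
    instance
      L≢0 : NonZero L
      L≢0 = m*n≢0 (Nf ℕ.* Ng) Nh {{m*n≢0 Nf Ng}}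
    z : ℕ → ℤ
    z k = awayFromZero s (k ℕ.* L)
    x : ℕ → Carrier
    x k = intR (z k)
    x-injective : ∀ {i j} → x i ≈ x j → i ≡ j
    x-injective e = *-cancelʳ-≡ _ _ L (intR-awayFromZero-injective char0 s e)
    agree : ∀ k → eval Pf (x k) ≈ eval (Pg +ₚ Ph) (x k)
    agree k = begin
      eval Pf (x k)
        ≈⟨ sym (constituent-on-progression f Nf cf qf s (∣n⇒∣m*n k (∣m⇒∣m*n Nh (m∣m*n Ng)))) ⟩
      f (z k)
        ≈⟨ f≈g+h (z k) ⟩
      g (z k) + h (z k)
        ≈⟨ +-cong (constituent-on-progression g Ng cg qg s (∣n⇒∣m*n k (n∣m*n*o Nf Nh)))
                  (constituent-on-progression h Nh ch qh s (∣n⇒∣m*n k (n∣m*n (Nf ℕ.* Ng)))) ⟩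
      eval Pg (x k) + eval Ph (x k)
        ≈⟨ sym (eval-+ₚ Pg Ph (x k)) ⟩
      eval (Pg +ₚ Ph) (x k) ∎

lemma2p8 : {c ℓ : Level} (R : CommutativeRing c ℓ)
    → QP.IsIntegralDomain R → QP.CharZero R
    → (f g h : ℤ → CommutativeRing.Carrier R)
    → (Nf Ng Nh : ℕ) .{{_ : NonZero Nf}} .{{_ : NonZero Ng}} .{{_ : NonZero Nh}}
    → (cf cg ch : ℕ → List (CommutativeRing.Carrier R))
    → QP.IsQP R f Nf cf → QP.IsMinimalPeriod R f Nf
    → QP.IsQP R g Ng cg → QP.IsMinimalPeriod R g Ng
    → QP.IsQP R h Nh ch → QP.IsMinimalPeriod R h Nh
    → (∀ t → CommutativeRing._≈_ R (f t) (CommutativeRing._+_ R (g t) (h t)))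
    → ∀ t → CommutativeRing._≈_ R (QP.sigma R Nf cf t)
              (CommutativeRing._+_ R (QP.sigma R Ng cg t) (QP.sigma R Nh ch t))
lemma2p8 R integral char0 f g h Nf Ng Nh cf cg ch qf _ qg _ qh _ =
  QuasiPolynomials.sigma-+ R integral char0 f g h Nf Ng Nh cf cg ch qf qg qh
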